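{- For any instance $I=(p_t)_{t\in[n]}$ and prediction $\hat I=(\hat p_t)_{t\in[n]}$, the auxiliary error $\tau([n],I,\hat I)$ satisfies: (Monotonicity) for every $S\subseteq[n]$, $\tau([n],I,\hat I)\ge\tau([n],I,I_S\cup\hat I_R)$, where $I_S\cup\hat I_R$ denotes the instance whose value at time $t$ is $p_t$ for $t\in S$ and $\hat p_t$ for $t\in[n]\setminus S$; (Lipschitzness) $|\mathrm{OPT}(I)-\mathrm{OPT}(\hat I)|\le\tau([n],I,\hat I)$.
   Context: Dynamic acknowledgment problem. Fix $d>0$. An instance is $I=(p_t)_{t\in[n]}$ with $p_t\ge0$ requests at time $t$. A solution $X=\{x_1<\dots<x_k\}$ is feasible if $x_k\ge\max\{t:p_t>0\}$; with $x_0=0$ its cost is $F(I,X)=|X|+\frac1d\sum_{i=1}^k\sum_{t=x_{i-1}+1}^{x_i}p_t(x_i-t)$; $\mathrm{OPT}(I)$ is the minimum cost of a feasible solution. $O(I,\hat I)=(\max\{p_t,\hat p_t\})_{t\in[n]}$, $U(I,\hat I)=(\min\{p_t,\hat p_t\})_{t\in[n]}$, and $\tau([n],I,\hat I)=\mathrm{OPT}(O(I,\hat I))-\mathrm{OPT}(U(I,\hat I))$.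
   Formalization: The request amounts $p_t$ and $\hat p_t$ and the parameter $d$ take values in the rationals. -}

module Defs where

open import Data.Bool using (Bool; true; false; if_then_else_; _∧_; not; _∨_)
open import Data.Nat as ℕ using (ℕ; zero; suc)
open import Data.Integer using (+_)
open import Data.Fin using (Fin; toℕ)
open import Data.Vec using (Vec; []; _∷_; lookup; replicate)
open import Data.List using (List; []; _∷_; map; foldr; filterᵇ; allFin; _++_)
open import Data.Maybe using (Maybe; just; nothing)
open import Data.Rational using (ℚ; 0ℚ; _+_; _*_; _-_; _⊓_; _⊔_; _≤ᵇ_; 1/_; _/_; Positive)
open import Data.Rational.Properties using (pos⇒nonZero)

-- Times are [n] = {1,…,n}; time t is represented by i : Fin n with t = toℕ i + 1.
-- An instance assigns a (rational, nonnegative) number of requests to each time.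
Instance : ℕ → Set
Instance n = Fin n → ℚ

-- A solution X ⊆ [n] (the acknowledgment times), as its characteristic vector.
Sol : ℕ → Set
Sol n = Vec Bool n

ℕ→ℚ : ℕ → ℚ
ℕ→ℚ k = + k / 1

card : ∀ {n} → Sol n → ℕ
card [] = 0
card (true ∷ X) = suc (card X)
card (false ∷ X) = card X

acksFrom : ∀ {n} → Sol n → Fin n → List (Fin n)
acksFrom X i = filterᵇ (λ j → (toℕ i ℕ.≤ᵇ toℕ j) ∧ lookup X j) (allFin _)

-- waiting time of a request at time i: x_j - t where x_j is the first
-- acknowledgment with x_j ≥ t (0 if there is none; only occurs for infeasible X
-- or for times with no requests)
wait : ∀ {n} → Sol n → Fin n → ℕ
wait X i with acksFrom X i
... | [] = 0
... | j ∷ _ = toℕ j ℕ.∸ toℕ i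

sumFin : ∀ {n} → (Fin n → ℚ) → ℚ
sumFin f = foldr _+_ 0ℚ (map f (allFin _))

cost : (d : ℚ) → .{{Positive d}} → ∀ {n} → Instance n → Sol n → ℚ
cost d {{pd}} I X =
  ℕ→ℚ (card X) + (1/ d) {{pos⇒nonZero d {{pd}}}} * sumFin (λ i → I i * ℕ→ℚ (wait X i))

allᵇ : ∀ {A : Set} → (A → Bool) → List A → Bool
allᵇ p [] = true
allᵇ p (x ∷ xs) = p x ∧ allᵇ p xs

-- X is feasible for I: x_k ≥ max{t : p_t > 0}, i.e. every time with p_t > 0
-- has some acknowledgment at or after it.
feasible : ∀ {n} → Instance n → Sol n → Bool
feasible I X = allᵇ (λ i → (I i ≤ᵇ 0ℚ) ∨ hasAck (acksFrom X i)) (allFin _)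
  where
  hasAck : ∀ {A : Set} → List A → Bool
  hasAck [] = false
  hasAck (_ ∷ _) = true

allSols : ∀ n → List (Sol n)
allSols zero = [] ∷ []
allSols (suc n) = map (true ∷_) (allSols n) ++ map (false ∷_) (allSols n)

-- OPT(I) = minimum cost over all feasible solutions (X = [n] is always feasible,
-- and is used as the initial value of the fold).
OPT : (d : ℚ) → .{{Positive d}} → ∀ {n} → Instance n → ℚ
OPT d {n} I = foldr _⊓_ (cost d I (replicate n true))
                (map (cost d I) (filterᵇ (feasible I) (allSols n)))

Omax : ∀ {n} → Instance n → Instance n → Instance n
Omax I J i = I i ⊔ J i

Umin : ∀ {n} → Instance n → Instance n → Instance n
Umin I J i = I i ⊓ J i

τ : (d : ℚ) → .{{Positive d}} → ∀ {n} → Instance n → Instance n → ℚ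
τ d I J = OPT d (Omax I J) - OPT d (Umin I J)

mix : ∀ {n} → (Fin n → Bool) → Instance n → Instance n → Instance n
mix S I J i = if S i then I i else J i

-- Raising the number of requests at any time raises the cost of every solution and can only
-- remove solutions from the feasible set, so OPT is monotone for the pointwise order on
-- instances.  Both I and Î, and every mixture of them, lie between U(I,Î) and O(I,Î);
-- hence OPT(I) and OPT(Î) lie in the interval [OPT(U), OPT(O)] of length τ, and replacing Î
-- by a mixture of I and Î shrinks that interval.
{-# OPTIONS --safe #-}
module Submission where

open import Defs
open import Data.Nat using (ℕ)
open import Data.Bool using (Bool; true; false; T; _∨_)
open import Data.Bool.Properties using (T-∧; T-∨)
open import Data.Fin using (Fin)
open import Data.List using (List; []; _∷_; map; foldr; filterᵇ; allFin)
open import Data.Product using (_×_; _,_)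
open import Data.Sum using (inj₁; inj₂; map₁)
open import Data.Vec using (replicate)
open import Data.Rational
  using (ℚ; 0ℚ; _≤_; _-_; ∣_∣; Positive; _+_; _*_; _⊓_; _⊔_; _≤ᵇ_; 1/_)
open import Data.Rational.Properties
open import Function using (_∘_)
open import Function.Bundles using (Equivalence)
open import Relation.Binary.PropositionalEquality using (subst; sym; trans)
open import Algebra.Properties.AbelianGroup +-0-abelianGroup using (⁻¹-anti-homo‿-)

open Equivalence using (to; from)

infix 4 _⊑_

_⊑_ : ∀ {n} → Instance n → Instance n → Set
I ⊑ J = ∀ i → I i ≤ J i

allᵇ-mono : ∀ {A : Set} {p q : A → Bool} → (∀ x → T (p x) → T (q x)) →
  ∀ xs → T (allᵇ p xs) → T (allᵇ q xs)
allᵇ-mono h []       _   = _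
allᵇ-mono h (x ∷ xs) pxs with to T-∧ pxs
... | px , pxs′ = from T-∧ (h x px , allᵇ-mono h xs pxs′)

T-∨-monoˡ : ∀ {a a′ b : Bool} → (T a → T a′) → T (a ∨ b) → T (a′ ∨ b)
T-∨-monoˡ h = from T-∨ ∘ map₁ h ∘ to T-∨

≤ᵇ-antitoneˡ : ∀ {p q r : ℚ} → p ≤ q → T (q ≤ᵇ r) → T (p ≤ᵇ r)
≤ᵇ-antitoneˡ {p} {q} {r} p≤q q≤r = ≤⇒≤ᵇ {p} {r} (≤-trans p≤q (≤ᵇ⇒≤ {q} {r} q≤r))

feasible-antitone : ∀ {n} {I J : Instance n} → I ⊑ J → ∀ X → T (feasible J X) → T (feasible I X)
feasible-antitone {n} {I} {J} I⊑J X =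
  allᵇ-mono (λ i → T-∨-monoˡ (≤ᵇ-antitoneˡ {I i} {J i} {0ℚ} (I⊑J i))) (allFin n)

sum-map-mono : ∀ {A : Set} {f g : A → ℚ} → (∀ x → f x ≤ g x) →
  ∀ xs → foldr _+_ 0ℚ (map f xs) ≤ foldr _+_ 0ℚ (map g xs)
sum-map-mono f≤g []       = ≤-refl
sum-map-mono f≤g (x ∷ xs) = +-mono-≤ (f≤g x) (sum-map-mono f≤g xs)

module _ (d : ℚ) .{{d>0 : Positive d}} where

  cost-mono : ∀ {n} {I J : Instance n} → I ⊑ J → ∀ X → cost d I X ≤ cost d J X
  cost-mono {n} {I} {J} I⊑J X =
    +-monoʳ-≤ (ℕ→ℚ (card X))
      (*-monoˡ-≤-nonNeg 1/d {{pos⇒nonNeg 1/d {{1/pos⇒pos d}}}}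
        (sum-map-mono weighted-wait-mono (allFin n)))
    where
    1/d : ℚ
    1/d = (1/ d) {{pos⇒nonZero d}}
    weighted-wait-mono : ∀ i → I i * ℕ→ℚ (wait X i) ≤ J i * ℕ→ℚ (wait X i)
    weighted-wait-mono i = *-monoʳ-≤-nonNeg (ℕ→ℚ (wait X i)) {{normalize-nonNeg (wait X i) 1}} (I⊑J i)

  minCost-mono : ∀ {n} {I J : Instance n} → I ⊑ J → {cI cJ : ℚ} → cI ≤ cJ → (Xs : List (Sol n)) →
    foldr _⊓_ cI (map (cost d I) (filterᵇ (feasible I) Xs)) ≤
    foldr _⊓_ cJ (map (cost d J) (filterᵇ (feasible J) Xs))
  minCost-mono I⊑J cI≤cJ [] = cI≤cJ
  minCost-mono {I = I} {J} I⊑J cI≤cJ (X ∷ Xs)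
    with feasible J X in J-feasible | feasible I X in I-feasible
  ... | true  | true  = ⊓-mono-≤ (cost-mono I⊑J X) (minCost-mono I⊑J cI≤cJ Xs)
  ... | true  | false
    with () ← subst T I-feasible (feasible-antitone I⊑J X (subst T (sym J-feasible) _))
  ... | false | true  = ≤-trans (p⊓q≤q (cost d I X) _) (minCost-mono I⊑J cI≤cJ Xs)
  ... | false | false = minCost-mono I⊑J cI≤cJ Xs

  OPT-mono : ∀ {n} {I J : Instance n} → I ⊑ J → OPT d I ≤ OPT d J
  OPT-mono {n} I⊑J = minCost-mono I⊑J (cost-mono I⊑J (replicate n true)) (allSols n)

sub-mono-≤ : ∀ {p q r s : ℚ} → p ≤ q → r ≤ s → p - s ≤ q - r
sub-mono-≤ p≤q r≤s = +-mono-≤ p≤q (neg-antimono-≤ r≤s)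

p,q∈[r,s]⇒∣p-q∣≤s-r : ∀ {p q r s : ℚ} → r ≤ p → p ≤ s → r ≤ q → q ≤ s → ∣ p - q ∣ ≤ s - r
p,q∈[r,s]⇒∣p-q∣≤s-r {p} {q} {r} {s} r≤p p≤s r≤q q≤s with ∣p∣≡p∨∣p∣≡-p (p - q)
... | inj₁ ∣p-q∣≡p-q = subst (_≤ s - r) (sym ∣p-q∣≡p-q) (sub-mono-≤ p≤s r≤q)
... | inj₂ ∣p-q∣≡q-p =
  subst (_≤ s - r) (sym (trans ∣p-q∣≡q-p (⁻¹-anti-homo‿- p q))) (sub-mono-≤ q≤s r≤p)

Umin⊑ˡ : ∀ {n} (I J : Instance n) → Umin I J ⊑ I
Umin⊑ˡ I J i = p⊓q≤p (I i) (J i)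

Umin⊑ʳ : ∀ {n} (I J : Instance n) → Umin I J ⊑ J
Umin⊑ʳ I J i = p⊓q≤q (I i) (J i)

⊑Omaxˡ : ∀ {n} (I J : Instance n) → I ⊑ Omax I J
⊑Omaxˡ I J i = p≤p⊔q (I i) (J i)

⊑Omaxʳ : ∀ {n} (I J : Instance n) → J ⊑ Omax I J
⊑Omaxʳ I J i = p≤q⊔p (I i) (J i)

Umin⊑Umin-mix : ∀ {n} (S : Fin n → Bool) (I J : Instance n) → Umin I J ⊑ Umin I (mix S I J)
Umin⊑Umin-mix S I J i with S i
... | true  = ⊓-glb (p⊓q≤p (I i) (J i)) (p⊓q≤p (I i) (J i))
... | false = ≤-refl

Omax-mix⊑Omax : ∀ {n} (S : Fin n → Bool) (I J : Instance n) → Omax I (mix S I J) ⊑ Omax I J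
Omax-mix⊑Omax S I J i with S i
... | true  = ⊔-lub (p≤p⊔q (I i) (J i)) (p≤p⊔q (I i) (J i))
... | false = ≤-refl

lemma2 : (d : ℚ) → .{{_ : Positive d}} → (n : ℕ) → (I Î : Instance n) →
    (∀ t → 0ℚ ≤ I t) → (∀ t → 0ℚ ≤ Î t) →
    ((S : Fin n → Bool) → τ d I (mix S I Î) ≤ τ d I Î)
    × (∣ OPT d I - OPT d Î ∣ ≤ τ d I Î)
lemma2 d n I Î _ _ = monotonicity , lipschitz
  where
  monotonicity : (S : Fin n → Bool) → τ d I (mix S I Î) ≤ τ d I Î
  monotonicity S = sub-mono-≤ (OPT-mono d (Omax-mix⊑Omax S I Î)) (OPT-mono d (Umin⊑Umin-mix S I Î))

  lipschitz : ∣ OPT d I - OPT d Î ∣ ≤ τ d I Î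
  lipschitz = p,q∈[r,s]⇒∣p-q∣≤s-r
    (OPT-mono d (Umin⊑ˡ I Î)) (OPT-mono d (⊑Omaxˡ I Î))
    (OPT-mono d (Umin⊑ʳ I Î)) (OPT-mono d (⊑Omaxʳ I Î))
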